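{- Let $k>1$ be an integer. If $[a_0;a_1]$ is a $(\sigma,k)$-permutiple for some permutation $\sigma$ of $\{0,1\}$, then there is an integer $s>1$ with $a_0=ks$ and $a_1=s$, i.e. the permutiple is $[ks;s]$.
   Context: For positive integers $a_0,\ldots,a_n$, $[a_0;a_1,\ldots,a_n]$ denotes the finite simple continued fraction $a_0+1/(a_1+1/(\cdots+1/a_n))$; all finite continued fractions are assumed in canonical form (last digit at least $2$ when there are at least two digits). For an integer $k>1$ and a permutation $\sigma$ of $\{0,\ldots,n\}$, $r=[a_0;\ldots,a_n]$ is a $(\sigma,k)$-permutiple if $r=k\,[a_{\sigma(0)};a_{\sigma(1)},\ldots,a_{\sigma(n)}]$. -}

module Defs where

open import Data.Nat using (ℕ; zero; suc; _+_; _*_; _≤_; _<_)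
open import Data.Fin using (Fin)
open import Data.Product using (_×_; _,_; proj₁; proj₂)
open import Data.Vec using (Vec; []; _∷_; lookup; tabulate)
open import Data.Vec.Relation.Unary.All using (All)
open import Function.Bundles using (_↔_; Inverse)
open import Relation.Binary.PropositionalEquality using (_≡_)

-- Numerator/denominator (p , q) of the finite continued fraction
-- [a₀; a₁, …, aₙ] with digits a₀ ∷ … ∷ aₙ, via the standard recursion
-- [a] = a/1 and [a; rest] = a + 1/[rest] = (a*p' + q')/p'  where rest = p'/q'.
cfFrac : ∀ {n} → Vec ℕ (suc n) → ℕ × ℕ
cfFrac (a ∷ []) = a , 1
cfFrac (a ∷ b ∷ rest) with cfFrac (b ∷ rest)
... | p , q = a * p + q , p

lastV : ∀ {n} → Vec ℕ (suc n) → ℕ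
lastV (a ∷ []) = a
lastV (a ∷ b ∷ rest) = lastV (b ∷ rest)

Canonical : ∀ {n} → Vec ℕ (suc n) → Set
Canonical {zero} v = All (1 ≤_) v
Canonical {suc n} v = All (1 ≤_) v × 2 ≤ lastV v

-- Equality of rationals p/q = k * (p'/q') (denominators positive for
-- positive digits), written by cross-multiplication.
-- r = [a₀;…;aₙ] is a (σ,k)-permutiple: r = k [a_{σ 0}; …; a_{σ n}],
-- where both continued fractions are required to be canonical.
IsPermutiple : ∀ {n} → (σ : Fin (suc n) ↔ Fin (suc n)) → ℕ → Vec ℕ (suc n) → Set
IsPermutiple {n} σ k a =
  Canonical a × Canonical b ×
  (proj₁ (cfFrac a) * proj₂ (cfFrac b) ≡ k * proj₁ (cfFrac b) * proj₂ (cfFrac a))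
  where
  b : Vec ℕ (suc n)
  b = tabulate (λ i → lookup a (Inverse.to σ i))

-- The continued fraction [a₀; a₁] has numerator/denominator
-- (a₀a₁ + 1, a₁), and a permutation σ of {0, 1} is either the identity or
-- the transposition.  Writing Q = a₀a₁ + 1 (which is positive), the
-- permutiple equation becomes, after cross-multiplication,
--   * for σ = id:    Q·a₁ = k·Q·a₁,  which forces k = 1, contradicting k > 1;
--   * for σ = swap:  Q·a₀ = k·Q·a₁,  so a₀ = k·a₁ after cancelling Q.
-- In the second case s = a₁ works, and s > 1 because the canonical form of
-- [a₀; a₁] requires its last digit a₁ to be at least 2.
module Submission where

open import Defs
open import Data.Nat using (ℕ; _*_; _+_; _<_; NonZero; >-nonZero)
open import Data.Nat.Properties using (*-cancelʳ-≡; *-identityˡ; *-assoc; *-comm; *-mono-≤; m≤n+m; <⇒≤; <-irrefl)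
open import Data.Fin using (Fin; zero; suc)
open import Data.Vec using (_∷_; []; lookup)
open import Data.Product using (Σ; _×_; _,_)
open import Data.Empty using (⊥-elim)
open import Function.Bundles using (_↔_; Inverse; Injection)
open import Function.Properties.Inverse using (↔⇒↣)
open import Relation.Binary.PropositionalEquality using (_≡_; _≢_; refl; sym; trans; cong; module ≡-Reasoning)

scalar-fixing-positive : ∀ k m .{{_ : NonZero m}} → m ≡ k * m → k ≡ 1
scalar-fixing-positive k m m≡km =
  sym (*-cancelʳ-≡ 1 k m (trans (*-identityˡ m) m≡km))

cancel-common-factor : ∀ k x y Q .{{_ : NonZero Q}} → Q * x ≡ k * Q * y → x ≡ k * y
cancel-common-factor k x y Q eq = *-cancelʳ-≡ x (k * y) Q (begin
  x * Q         ≡⟨ *-comm x Q ⟩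
  Q * x         ≡⟨ eq ⟩
  k * Q * y     ≡⟨ *-assoc k Q y ⟩
  k * (Q * y)   ≡⟨ cong (k *_) (*-comm Q y) ⟩
  k * (y * Q)   ≡⟨ sym (*-assoc k y Q) ⟩
  k * y * Q     ∎)
  where open ≡-Reasoning

permutation-separates : ∀ {n} (σ : Fin n ↔ Fin n) {i j : Fin n} →
  i ≢ j → Inverse.to σ i ≢ Inverse.to σ j
permutation-separates σ i≢j σi≡σj = i≢j (Injection.injective (↔⇒↣ σ) σi≡σj)

two-digit-permutiple : ∀ k → 1 < k → ∀ a₀ a₁ (i j : Fin 2) → i ≢ j →
  let v = a₀ ∷ a₁ ∷ [] in
  Canonical v →
  (a₀ * a₁ + 1) * lookup v j ≡ k * (lookup v i * lookup v j + 1) * a₁ →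
  Σ ℕ (λ s → 1 < s × a₀ ≡ k * s × a₁ ≡ s)
two-digit-permutiple k k>1 a₀ a₁ zero zero i≢j _ _ = ⊥-elim (i≢j refl)
two-digit-permutiple k k>1 a₀ a₁ (suc zero) (suc zero) i≢j _ _ = ⊥-elim (i≢j refl)
two-digit-permutiple k k>1 a₀ a₁ zero (suc zero) _ (_ , 2≤a₁) eq =
  ⊥-elim (<-irrefl (sym (scalar-fixing-positive k P P≡kP)) k>1)
  where
  P : ℕ
  P = (a₀ * a₁ + 1) * a₁
  instance
    P-nonZero : NonZero P
    P-nonZero = >-nonZero (*-mono-≤ (m≤n+m 1 (a₀ * a₁)) (<⇒≤ 2≤a₁))
  P≡kP : P ≡ k * P
  P≡kP = trans eq (*-assoc k (a₀ * a₁ + 1) a₁)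
two-digit-permutiple k k>1 a₀ a₁ (suc zero) zero _ (_ , 2≤a₁) eq =
  a₁ , 2≤a₁ , a₀≡ka₁ , refl
  where
  Q : ℕ
  Q = a₀ * a₁ + 1
  instance
    Q-nonZero : NonZero Q
    Q-nonZero = >-nonZero (m≤n+m 1 (a₀ * a₁))
  a₀≡ka₁ : a₀ ≡ k * a₁
  a₀≡ka₁ = cancel-common-factor k a₀ a₁ Q
    (trans eq (cong (λ t → k * (t + 1) * a₁) (*-comm a₁ a₀)))

mainTheorem3 : (k : ℕ) → 1 < k → (a₀ a₁ : ℕ) → (σ : Fin 2 ↔ Fin 2) →
    IsPermutiple σ k (a₀ ∷ a₁ ∷ []) →
    Σ ℕ (λ s → 1 < s × a₀ ≡ k * s × a₁ ≡ s)
mainTheorem3 k k>1 a₀ a₁ σ (canonical-a , _ , eq) =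
  two-digit-permutiple k k>1 a₀ a₁ (to zero) (to (suc zero))
    (permutation-separates σ (λ ())) canonical-a eq
  where open Inverse σ
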